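{- Let $W$ and $V$ be $d$-dimensional worlds, $B=(U_B,L_B)$ a barrier of $W$ with middle set $M_B$, and $C=(U_C,L_C)$ a barrier of $V$ with middle set $M_C$, and suppose $B$ and $C$ are partially isomorphic with these middle sets and translation vector $t \in \mathbb{Z}^d$. Let $p \in M_B$ and let $q \in M_C$ be the position with $l_W(p) = l_V(q) + t$. Then $p$ is a $\mathcal{P}$-position if and only if $q$ is a $\mathcal{P}$-position.
   Context: Tree nim: a position is a finite tree, possibly empty, whose vertices carry positive integer sizes; a leaf is a vertex of degree at most $1$; a move chooses a leaf and decreases its size by a positive integer, deleting the vertex if its size becomes $0$; normal play. $p \rightarrow q$ means $q$ is reachable from $p$ in one move. A position is $\mathcal{P}$ iff no move leads to a $\mathcal{P}$-position. World: fix a finite tree $T$ with $d$ leaves ordered $l_1,\dots,l_d$ and positive sizes for its non-leaf vertices. Interior positions: underlying tree $T$, these non-leaf sizes, arbitrary positive leaf sizes; the world $W$ consists of interior positions together with all positions seen by some interior position; non-interior positions of $W$ are exterior. The lattice map $l_W$ sends a position to the tuple of sizes of $l_1,\dots,l_d$ ($0$ for a deleted leaf), a bijection onto $\{(n_1,\dots,n_d)\in\mathbb{N}_0^d: \text{at most one } n_i=0\}$. A ray in $W$ is a family $(r_m)_{m\ge0}$ with $l_W(r_m) = (a_1,\dots,a_{k-1},m,a_{k+1},\dots,a_d)$, $k$ its variable coordinate, the positive $a_i$ ($i\neq k$) its fixed coordinates; each ray contains exactly one $\mathcal{P}$-position $r_m$, and $\mathcal{P}(R)=m$. Barrier: partition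 $W=U_B\sqcup L_B$ with $U_B$ containing all exterior positions and such that $p\in U_B$, $q \in W$, $p\rightarrow q$ imply $q\in U_B$. A ray meeting $L_B$ is shadowed if $\mathcal{P}(R)<n_0$, $n_0$ the least $m$ with $r_m\in L_B$; other rays are not shadowed; $S(B)$ is the set of shadowed rays. A middle set for $B$ is a subset $M_B\subseteq L_B$ such that for any $p\in M_B$ and any $q\in W$ with $p\rightarrow q$, $q\in U_B\cup M_B$. Given $t\in\mathbb{Z}^d$, rays $R$ of $W$ and $R'$ of $V$ correspond if they have the same variable coordinate $k$ and fixed coordinates satisfying $a_i=b_i+t_i$ for all $i\neq k$. A partial isomorphism of $B$ and $C$ (with middle sets $M_B$, $M_C$ and translation $t$) means: $l_W(M_B) = l_V(M_C)+t$, and for every ray $R$ of $W$ with $R\cap M_B\neq\emptyset$ and its corresponding ray $R'$ of $V$, $R\in S(B)\iff R'\in S(C)$. -}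

module Defs where

open import Data.Nat using (ℕ; zero; suc; _+_; _*_; _∸_; _≤_; _<_)
open import Data.Integer as ℤ using (ℤ; +_)
open import Data.Fin using (Fin; zero; suc; punchIn; _≟_)
open import Data.Fin.Properties using (any?)
open import Data.Vec using (Vec; lookup; _[_]≔_)
open import Data.Bool using (Bool; true; false; if_then_else_)
open import Data.Product using (Σ; ∃; _×_; _,_)
open import Data.Sum using (_⊎_)
open import Data.Unit using (⊤)
open import Data.Empty using (⊥)
open import Function using (_∘_)
open import Function.Bundles using (_⇔_)
open import Relation.Nullary using (¬_; yes; no; does)
open import Relation.Binary.PropositionalEquality using (_≡_; _≢_)
open import Relation.Binary.Construct.Closure.ReflexiveTransitive using (Star)
import Data.Nat as ℕ

-- Tree nim positions (labelled finite graphs with vertex sizes).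
-- Vertex identities are tracked through deletions via punchIn.

record Pos : Set where
  constructor mkPos
  field
    n    : ℕ
    size : Fin n → ℕ
    adj  : Fin n → Fin n → Bool

sumFin : (n : ℕ) → (Fin n → ℕ) → ℕ
sumFin zero    f = 0
sumFin (suc n) f = f zero + sumFin n (f ∘ suc)

degree : (n : ℕ) → (Fin n → Fin n → Bool) → Fin n → ℕ
degree n a v = sumFin n (λ j → if a v j then 1 else 0)

IsLeaf : (n : ℕ) → (Fin n → Fin n → Bool) → Fin n → Set
IsLeaf n a v = degree n a v ≤ 1

-- one move: choose a leaf, decrease its size by a positive integer k;
-- if the size becomes 0 the vertex is deleted.
data Move : Pos → Pos → Set where
  shrink : ∀ {n s s′ a a′} (v : Fin n) (k : ℕ) → IsLeaf n a v → 0 < k → k < s v →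
           (∀ i → s′ i ≡ (if does (i ≟ v) then s v ∸ k else s i)) →
           (∀ i j → a′ i j ≡ a i j) →
           Move (mkPos n s a) (mkPos n s′ a′)
  remove : ∀ {m s s′ a a′} (v : Fin (suc m)) → IsLeaf (suc m) a v → 0 < s v →
           (∀ i → s′ i ≡ s (punchIn v i)) →
           (∀ i j → a′ i j ≡ a (punchIn v i) (punchIn v j)) →
           Move (mkPos (suc m) s a) (mkPos m s′ a′)

-- every move strictly decreases this measure
measure : Pos → ℕ
measure (mkPos n s a) = n + sumFin n s

-- P-positions (normal play): no move leads to a P-position.
-- Defined by recursion on fuel; fuel = measure suffices since moves decrease it.
Pfuel : ℕ → Pos → Set
Pfuel zero    p = ⊤
Pfuel (suc f) p = ∀ q → Move p q → ¬ Pfuel f q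

IsP : Pos → Set
IsP p = Pfuel (measure p) p

IsTree : (n : ℕ) → (Fin n → Fin n → Bool) → Set
IsTree n a =
  (∀ i j → a i j ≡ a j i) ×
  (∀ i → a i i ≡ false) ×
  (∀ i j → Star (λ u v → a u v ≡ true) i j) ×
  (sumFin n (degree n a) ≡ 2 * (n ∸ 1))

record World (d : ℕ) : Set where
  field
    n        : ℕ
    adj      : Fin n → Fin n → Bool
    isTree   : IsTree n adj
    leaf     : Fin d → Fin n
    leafInj  : ∀ i j → leaf i ≡ leaf j → i ≡ j
    leafLeaf : ∀ i → IsLeaf n adj (leaf i)
    allLeaf  : ∀ v → IsLeaf n adj v → ∃ λ i → leaf i ≡ v
    inner    : Fin n → ℕ                         -- sizes of non-leaf vertices
    innerPos : ∀ v → ¬ IsLeaf n adj v → 0 < inner v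

AtMostOneZero : ∀ {d} → Vec ℕ d → Set
AtMostOneZero x = ∀ i j → lookup x i ≡ 0 → lookup x j ≡ 0 → i ≡ j

ExteriorPt : ∀ {d} → Vec ℕ d → Set
ExteriorPt x = ∃ λ i → lookup x i ≡ 0

module _ {d : ℕ} (W : World d) where
  open World W

  sizeAt : Vec ℕ d → Fin n → ℕ
  sizeAt x v with any? (λ i → leaf i ≟ v)
  ... | yes (i , _) = lookup x i
  ... | no _        = inner v

  full : Vec ℕ d → Pos
  full x = mkPos n (sizeAt x) adj

  deleteVertex : (p : Pos) → Fin (Pos.n p) → Pos
  deleteVertex (mkPos (suc m) s a) v =
    mkPos m (s ∘ punchIn v) (λ i j → a (punchIn v i) (punchIn v j))

  -- the inverse of the lattice map l_W: the position of W with leaf tuple x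
  -- (if x_i = 0 the leaf l_i is deleted)
  pos : Vec ℕ d → Pos
  pos x with any? (λ i → lookup x i ℕ.≟ 0)
  ... | yes (i , _) = deleteVertex (full x) (leaf i)
  ... | no _        = full x

  _⟶_ : Vec ℕ d → Vec ℕ d → Set
  x ⟶ y = Move (pos x) (pos y)

  -- Barriers: side x ≡ true means x ∈ U_B, side x ≡ false means x ∈ L_B
  record Barrier : Set where
    field
      side   : Vec ℕ d → Bool
      extU   : ∀ x → AtMostOneZero x → ExteriorPt x → side x ≡ true
      closed : ∀ x y → AtMostOneZero x → AtMostOneZero y →
               side x ≡ true → x ⟶ y → side y ≡ true

  IsMiddleSet : Barrier → (Vec ℕ d → Set) → Set
  IsMiddleSet B M =
    (∀ x → M x → AtMostOneZero x × Barrier.side B x ≡ false) ×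
    (∀ x y → M x → AtMostOneZero y → x ⟶ y →
       Barrier.side B y ≡ true ⊎ M y)

  -- rays: variable coordinate k, fixed coordinates a (a's k-th entry unused)
  FixedPos : Fin d → Vec ℕ d → Set
  FixedPos k a = ∀ i → i ≢ k → 0 < lookup a i

  ray : Fin d → Vec ℕ d → ℕ → Vec ℕ d
  ray k a m = a [ k ]≔ m

  -- R meets L_B, and P(R) < n₀ (n₀ least m with r_m ∈ L_B), i.e.
  -- the P-position r_{P(R)} and all r_m with m ≤ P(R) lie in U_B.
  Shadowed : Barrier → Fin d → Vec ℕ d → Set
  Shadowed B k a =
    (∃ λ m → Barrier.side B (ray k a m) ≡ false) ×
    (∃ λ m → IsP (pos (ray k a m)) ×
       (∀ m′ → m′ ≤ m → Barrier.side B (ray k a m′) ≡ true))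

Translates : ∀ {d} → Vec ℤ d → Vec ℕ d → Vec ℕ d → Set
Translates t x y = ∀ i → + lookup x i ≡ + lookup y i ℤ.+ lookup t i

PartiallyIsomorphic : ∀ {d} (W V : World d) (B : Barrier W) (C : Barrier V) →
  (Vec ℕ d → Set) → (Vec ℕ d → Set) → Vec ℤ d → Set
PartiallyIsomorphic {d} W V B C MB MC t =
  (∀ x → MB x → ∃ λ y → MC y × Translates t x y) ×
  (∀ y → MC y → ∃ λ x → MB x × Translates t x y) ×
  (∀ (k : Fin d) (a b : Vec ℕ d) → FixedPos W k a → FixedPos V k b →
     (∀ i → i ≢ k → + lookup a i ≡ + lookup b i ℤ.+ lookup t i) →
     (∃ λ m → MB (ray W k a m)) →
     (Shadowed W B k a ⇔ Shadowed V C k b))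

{-# OPTIONS --safe #-}
module Submission where

-- Induction on the total measure of the two positions. Negating the translation
-- makes partial isomorphism symmetric, so it suffices to show that q is P when p
-- is. A move from q goes down a ray through q, to a point of M_C or of U_C. In
-- M_C it is matched by a move of p to the corresponding point of M_B, and the
-- induction hypothesis for the reversed isomorphism applies. In U_C the ray
-- through q is shadowed, because U_C is closed downwards along rays. Then the
-- corresponding ray through p is shadowed too, and p ∈ L_B can move to the
-- P-position of that ray.

open import Defs
import Data.Nat as ℕ
open import Data.Nat using (ℕ; zero; suc; _+_; _∸_; _≤_; _<_; z≤n; s≤s; z<s; s≤s⁻¹)
open import Data.Nat.Properties
  using (+-comm; +-commutativeSemigroup; +-monoʳ-≤; +-monoʳ-<; +-monoˡ-<; +-mono-<; m≤n+m;
         <-irrefl; <⇒≤; <⇒≱; ≤-refl; ≤-trans; <-≤-trans; n≤1+n; n<1+n; ≮⇒≥; _<?_;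
         n≢0⇒n>0; m≤n⇒m<n∨m≡n; ∸-monoʳ-<; m∸[m∸n]≡n; m<n⇒0<n∸m)
open import Algebra.Properties.CommutativeSemigroup +-commutativeSemigroup using (x∙yz≈y∙xz)
open import Data.Integer as ℤ using (ℤ; +_; +<+)
open import Data.Integer.Properties as ℤP using (+-injective; drop‿+<+)
open import Data.Fin using (Fin; zero; suc; punchIn; _≟_)
open import Data.Fin.Properties using (punchInᵢ≢i; any?)
open import Data.Vec using (Vec; lookup; map; _[_]≔_)
open import Data.Vec.Properties using (lookup∘update; lookup∘update′; []≔-idempotent; []≔-lookup; lookup-map)
open import Data.Vec.Relation.Binary.Pointwise.Extensional using (ext; Pointwise-≡⇒≡)
open import Data.Bool using (true; false; if_then_else_)
open import Data.Product using (Σ; ∃; _×_; _,_; proj₁; proj₂)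
open import Data.Sum using (inj₁; inj₂; [_,_]′)
open import Data.Unit using (tt)
open import Data.Empty using (⊥; ⊥-elim)
open import Function using (_∘_)
open import Function.Bundles using (_⇔_; mk⇔; Equivalence)
import Function.Properties.Equivalence as ⇔
open import Relation.Nullary using (¬_; yes; no; does)
open import Relation.Binary.PropositionalEquality

sumFin-cong : ∀ n {f g : Fin n → ℕ} → (∀ i → f i ≡ g i) → sumFin n f ≡ sumFin n g
sumFin-cong zero    e = refl
sumFin-cong (suc n) e = cong₂ _+_ (e zero) (sumFin-cong n (e ∘ suc))

sumFin-punchIn : ∀ m (f : Fin (suc m) → ℕ) v → sumFin (suc m) f ≡ f v + sumFin m (f ∘ punchIn v)
sumFin-punchIn m       f zero    = refl
sumFin-punchIn (suc m) f (suc v) =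
  trans (cong (λ z → f zero + z) (sumFin-punchIn m (f ∘ suc) v)) (x∙yz≈y∙xz (f zero) (f (suc v)) _)

sumFin-< : ∀ n {s s′ : Fin n → ℕ} v → (∀ i → i ≢ v → s′ i ≡ s i) → s′ v < s v →
           sumFin n s′ < sumFin n s
sumFin-< (suc m) {s} {s′} v e lt
  rewrite sumFin-punchIn m s v | sumFin-punchIn m s′ v
        | sumFin-cong m {s′ ∘ punchIn v} (λ i → e (punchIn v i) (punchInᵢ≢i v i)) =
  +-monoˡ-< (sumFin m (s ∘ punchIn v)) lt

infix 4 _≈ₚ_

data _≈ₚ_ : Pos → Pos → Set where
  ≈ₚ-intro : ∀ {n s s′ a a′} → (∀ i → s i ≡ s′ i) → (∀ i j → a i j ≡ a′ i j) →
             mkPos n s a ≈ₚ mkPos n s′ a′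

≈ₚ-sym : ∀ {p q} → p ≈ₚ q → q ≈ₚ p
≈ₚ-sym (≈ₚ-intro es ea) = ≈ₚ-intro (sym ∘ es) (λ i j → sym (ea i j))

measure-resp : ∀ {p q} → p ≈ₚ q → measure p ≡ measure q
measure-resp (≈ₚ-intro {n} es _) = cong (λ z → n + z) (sumFin-cong n es)

IsLeaf-resp : ∀ {n a a′ v} → (∀ i j → a i j ≡ a′ i j) → IsLeaf n a v → IsLeaf n a′ v
IsLeaf-resp {n} {v = v} ea = subst (_≤ 1) (sumFin-cong n (λ j → cong (λ b → if b then 1 else 0) (ea v j)))

Move-respˡ : ∀ {p p′ q} → p ≈ₚ p′ → Move p q → Move p′ q
Move-respˡ (≈ₚ-intro es ea) (shrink v k lf 0<k k<s e₁ e₂) =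
  shrink v k (IsLeaf-resp ea lf) 0<k (subst (k <_) (es v) k<s)
    (λ i → trans (e₁ i) (cong₂ (λ x y → if does (i ≟ v) then x ∸ k else y) (es v) (es i)))
    (λ i j → trans (e₂ i j) (ea i j))
Move-respˡ (≈ₚ-intro es ea) (remove v lf 0<s e₁ e₂) =
  remove v (IsLeaf-resp ea lf) (subst (0 <_) (es v) 0<s)
    (λ i → trans (e₁ i) (es _)) (λ i j → trans (e₂ i j) (ea _ _))

Move-respʳ : ∀ {p q q′} → q ≈ₚ q′ → Move p q → Move p q′
Move-respʳ (≈ₚ-intro es ea) (shrink v k lf 0<k k<s e₁ e₂) =
  shrink v k lf 0<k k<s (λ i → trans (sym (es i)) (e₁ i)) (λ i j → trans (sym (ea i j)) (e₂ i j))
Move-respʳ (≈ₚ-intro es ea) (remove v lf 0<s e₁ e₂) =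
  remove v lf 0<s (λ i → trans (sym (es i)) (e₁ i)) (λ i j → trans (sym (ea i j)) (e₂ i j))

measure-< : ∀ {p q} → Move p q → measure q < measure p
measure-< {mkPos n s _} (shrink v k _ 0<k k<s e₁ _) =
  +-monoʳ-< n (sumFin-< n v (λ i i≢v → trans (e₁ i) (if-no i≢v))
                            (subst (_< s v) (sym (trans (e₁ v) if-yes)) (∸-monoʳ-< 0<k (<⇒≤ k<s))))
  where
  if-no : ∀ {i x y} → i ≢ v → (if does (i ≟ v) then x else y) ≡ y
  if-no {i} i≢v with i ≟ v
  ... | yes i≡v = ⊥-elim (i≢v i≡v)
  ... | no _    = refl
  if-yes : ∀ {x y} → (if does (v ≟ v) then x else y) ≡ x
  if-yes with v ≟ v
  ... | yes _   = refl
  ... | no v≢v  = ⊥-elim (v≢v refl)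
measure-< {mkPos (suc m) s _} (remove v _ _ e₁ _)
  rewrite sumFin-punchIn m s v | sumFin-cong m e₁ =
  s≤s (+-monoʳ-≤ m (m≤n+m _ _))

Pfuel-stable : ∀ f g p → measure p ≤ f → measure p ≤ g → Pfuel f p → Pfuel g p
Pfuel-stable f       zero    p _   _   _ = tt
Pfuel-stable zero    (suc g) p p≤0 _   _ q mv _ = <⇒≱ (measure-< mv) (≤-trans p≤0 z≤n)
Pfuel-stable (suc f) (suc g) p p≤f p≤g P q mv Pq =
  P q mv (Pfuel-stable g f q (s≤s⁻¹ (≤-trans (measure-< mv) p≤g))
                             (s≤s⁻¹ (≤-trans (measure-< mv) p≤f)) Pq)

IsP-elim : ∀ {p q} → IsP p → Move p q → ¬ IsP q
IsP-elim {p} {q} P mv Pq =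
  Pfuel-stable (measure p) (suc (measure p)) p ≤-refl (n≤1+n _) P q mv
    (Pfuel-stable (measure q) (measure p) q ≤-refl (<⇒≤ (measure-< mv)) Pq)

IsP-intro : ∀ {p} → (∀ q → Move p q → ¬ IsP q) → IsP p
IsP-intro {p} noP = Pfuel-stable (suc (measure p)) (measure p) p (n≤1+n _) ≤-refl
  (λ q mv Pq → noP q mv (Pfuel-stable (measure p) (measure q) q (<⇒≤ (measure-< mv)) ≤-refl Pq))

Pfuel-resp : ∀ f {p p′} → p ≈ₚ p′ → Pfuel f p → Pfuel f p′
Pfuel-resp zero    _     _ = tt
Pfuel-resp (suc f) p≈p′ P q mv = P q (Move-respˡ (≈ₚ-sym p≈p′) mv)

IsP-resp : ∀ {p p′} → p ≈ₚ p′ → IsP p → IsP p′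
IsP-resp {p} {p′} p≈p′ P = subst (λ f → Pfuel f p′) (measure-resp p≈p′) (Pfuel-resp (measure p) p≈p′ P)

-- The same as deleteVertex, which takes a world argument that it never uses.
removeVertex : (p : Pos) → Fin (Pos.n p) → Pos
removeVertex (mkPos (suc m) s a) v = mkPos m (s ∘ punchIn v) (λ i j → a (punchIn v i) (punchIn v j))

infixl 6 _[_]≔ₚ_

_[_]≔ₚ_ : (p : Pos) → Fin (Pos.n p) → ℕ → Pos
p            [ v ]≔ₚ zero  = removeVertex p v
mkPos n s a  [ v ]≔ₚ suc j = mkPos n (λ i → if does (i ≟ v) then suc j else s i) a

update-move : ∀ p v j → IsLeaf (Pos.n p) (Pos.adj p) v → j < Pos.size p v → Move p (p [ v ]≔ₚ j)
update-move (mkPos (suc m) s a) v zero lf j<s = remove v lf j<s (λ _ → refl) (λ _ _ → refl)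
update-move (mkPos n s a) v (suc j) lf j<s =
  shrink v (s v ∸ suc j) lf (m<n⇒0<n∸m j<s) (∸-monoʳ-< z<s (<⇒≤ j<s))
    (λ i → cong (λ x → if does (i ≟ v) then x else s i) (sym (m∸[m∸n]≡n (<⇒≤ j<s))))
    (λ _ _ → refl)

move⇒update : ∀ {p q} → Move p q →
  Σ (Fin (Pos.n p)) λ v → Σ ℕ λ j →
    IsLeaf (Pos.n p) (Pos.adj p) v × j < Pos.size p v × q ≈ₚ p [ v ]≔ₚ j
move⇒update {mkPos n s a} (shrink v k lf 0<k k<s e₁ e₂) with s v ∸ k in eq
... | zero  = ⊥-elim (<-irrefl (sym eq) (m<n⇒0<n∸m k<s))
... | suc j = v , suc j , lf , subst (_< s v) eq (∸-monoʳ-< 0<k (<⇒≤ k<s)) , ≈ₚ-intro e₁ e₂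
move⇒update (remove v lf 0<s e₁ e₂) = v , zero , lf , 0<s , ≈ₚ-intro e₁ e₂

Interior : ∀ {d} → Vec ℕ d → Set
Interior x = ∀ i → 0 < lookup x i

update-interior : ∀ {d} {x : Vec ℕ d} {k j} → Interior x → 0 < j → Interior (x [ k ]≔ j)
update-interior {x = x} {k} {j} hx 0<j i with i ≟ k
... | yes refl = subst (0 <_) (sym (lookup∘update i x j)) 0<j
... | no i≢k   = subst (0 <_) (sym (lookup∘update′ i≢k x j)) (hx i)

update-atMostOneZero : ∀ {d} {x : Vec ℕ d} {k j} → Interior x → AtMostOneZero (x [ k ]≔ j)
update-atMostOneZero {x = x} {k} {j} hx i i′ e e′ = trans (zero-at-k i e) (sym (zero-at-k i′ e′))
  where
  zero-at-k : ∀ i → lookup (x [ k ]≔ j) i ≡ 0 → i ≡ k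
  zero-at-k i e with i ≟ k
  ... | yes i≡k = i≡k
  ... | no i≢k  = ⊥-elim (<-irrefl (trans (sym e) (lookup∘update′ i≢k x j)) (hx i))

agreeExcept⇒≡[]≔ : ∀ {d} {xs ys : Vec ℕ d} k → (∀ i → i ≢ k → lookup xs i ≡ lookup ys i) →
                   xs ≡ ys [ k ]≔ lookup xs k
agreeExcept⇒≡[]≔ {xs = xs} {ys} k agree = Pointwise-≡⇒≡ (ext pointwise)
  where
  pointwise : ∀ i → lookup xs i ≡ lookup (ys [ k ]≔ lookup xs k) i
  pointwise i with i ≟ k
  ... | yes refl = sym (lookup∘update i ys (lookup xs i))
  ... | no i≢k   = trans (agree i i≢k) (sym (lookup∘update′ i≢k ys (lookup xs k)))

TranslatesExcept : ∀ {d} → Fin d → Vec ℤ d → Vec ℕ d → Vec ℕ d → Set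
TranslatesExcept k t x y = ∀ i → i ≢ k → + lookup x i ≡ + lookup y i ℤ.+ lookup t i

Translates-[]≔ : ∀ {d} (t : Vec ℤ d) x y k j → Translates t x (y [ k ]≔ j) → TranslatesExcept k t x y
Translates-[]≔ t x y k j x~y i i≢k =
  trans (x~y i) (cong (λ z → + z ℤ.+ lookup t i) (lookup∘update′ i≢k y j))

TranslatesExcept-unique : ∀ {d} (t : Vec ℤ d) x x′ z k →
  TranslatesExcept k t x z → TranslatesExcept k t x′ z → x′ ≡ x [ k ]≔ lookup x′ k
TranslatesExcept-unique t x x′ z k x~z x′~z =
  agreeExcept⇒≡[]≔ k (λ i i≢k → +-injective (trans (x′~z i i≢k) (sym (x~z i i≢k))))

Translates-< : ∀ {d} (t : Vec ℤ d) x y x′ y′ k → Translates t x y → Translates t x′ y′ →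
               lookup y′ k < lookup y k → lookup x′ k < lookup x k
Translates-< t x y x′ y′ k x~y x′~y′ y′<y =
  drop‿+<+ (subst₂ ℤ._<_ (sym (x′~y′ k)) (sym (x~y k)) (ℤP.+-monoˡ-< (lookup t k) (+<+ y′<y)))

shift-flip : ∀ a b t → + a ≡ + b ℤ.+ t → + b ≡ + a ℤ.+ ℤ.- t
shift-flip a b t a≡b+t = begin
  + b                    ≡⟨ ℤP.+-identityʳ (+ b) ⟨
  + b ℤ.+ ℤ.+0           ≡⟨ cong (λ z → + b ℤ.+ z) (ℤP.+-inverseʳ t) ⟨
  + b ℤ.+ (t ℤ.+ ℤ.- t)  ≡⟨ ℤP.+-assoc (+ b) t (ℤ.- t) ⟨
  + b ℤ.+ t ℤ.+ ℤ.- t    ≡⟨ cong (ℤ._+ ℤ.- t) a≡b+t ⟨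
  + a ℤ.+ ℤ.- t          ∎
  where open ≡-Reasoning

Translates-sym : ∀ {d} (t : Vec ℤ d) x y → Translates t x y → Translates (map ℤ.-_ t) y x
Translates-sym t x y x~y i =
  trans (shift-flip (lookup x i) (lookup y i) (lookup t i) (x~y i))
        (cong (λ z → + lookup x i ℤ.+ z) (sym (lookup-map i ℤ.-_ t)))

true≢false : true ≢ false
true≢false ()

module _ {d} (W : World d) where
  open World W

  sizeAt-leaf : ∀ x k → sizeAt W x (leaf k) ≡ lookup x k
  sizeAt-leaf x k with any? (λ i → leaf i ≟ leaf k)
  ... | yes (i , lᵢ≡lₖ) = cong (lookup x) (leafInj i k lᵢ≡lₖ)
  ... | no ¬leaf        = ⊥-elim (¬leaf (k , refl))

  sizeAt-update-other : ∀ {x k j u} → u ≢ leaf k → sizeAt W (x [ k ]≔ j) u ≡ sizeAt W x u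
  sizeAt-update-other {x} {k} {j} {u} u≢lₖ with any? (λ i → leaf i ≟ u)
  ... | no _          = refl
  ... | yes (i , lᵢ≡u) = lookup∘update′ (λ i≡k → u≢lₖ (trans (sym lᵢ≡u) (cong leaf i≡k))) x j

  pos-interior : ∀ x → Interior x → pos W x ≡ full W x
  pos-interior x hx with any? (λ i → lookup x i ℕ.≟ 0)
  ... | yes (i , xᵢ≡0) = ⊥-elim (<-irrefl (sym xᵢ≡0) (hx i))
  ... | no _           = refl

  pos-deleted : ∀ x k → lookup x k ≡ 0 → (∀ i → i ≢ k → 0 < lookup x i) →
                pos W x ≡ deleteVertex W (full W x) (leaf k)
  pos-deleted x k xₖ≡0 hx with any? (λ i → lookup x i ℕ.≟ 0)
  ... | no ¬zero       = ⊥-elim (¬zero (k , xₖ≡0))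
  ... | yes (i , xᵢ≡0) with i ≟ k
  ...   | yes refl = refl
  ...   | no i≢k   = ⊥-elim (<-irrefl (sym xᵢ≡0) (hx i i≢k))

  removeVertex≈deleteVertex : ∀ {m} (s s′ : Fin m → ℕ) a v → (∀ i → i ≢ v → s i ≡ s′ i) →
                              removeVertex (mkPos m s a) v ≈ₚ deleteVertex W (mkPos m s′ a) v
  removeVertex≈deleteVertex {suc m} s s′ a v agree =
    ≈ₚ-intro (λ i → agree (punchIn v i) (punchInᵢ≢i v i)) (λ _ _ → refl)

  pos-update : ∀ {y} → Interior y → ∀ k j → full W y [ leaf k ]≔ₚ j ≈ₚ pos W (y [ k ]≔ j)
  pos-update {y} hy k zero
    rewrite pos-deleted (y [ k ]≔ 0) k (lookup∘update k y 0)
              (λ i i≢k → subst (0 <_) (sym (lookup∘update′ i≢k y 0)) (hy i)) =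
    removeVertex≈deleteVertex (sizeAt W y) (sizeAt W (y [ k ]≔ 0)) adj (leaf k)
      (λ i i≢lₖ → sym (sizeAt-update-other i≢lₖ))
  pos-update {y} hy k (suc j)
    rewrite pos-interior (y [ k ]≔ suc j) (update-interior {x = y} {k} hy z<s) =
    ≈ₚ-intro sizes (λ _ _ → refl)
    where
    sizes : ∀ i → (if does (i ≟ leaf k) then suc j else sizeAt W y i) ≡ sizeAt W (y [ k ]≔ suc j) i
    sizes i with i ≟ leaf k
    ... | yes refl = sym (trans (sizeAt-leaf (y [ k ]≔ suc j) k) (lookup∘update k y (suc j)))
    ... | no i≢lₖ  = sym (sizeAt-update-other i≢lₖ)

  lattice-move : ∀ {y k j} → Interior y → j < lookup y k → Move (pos W y) (pos W (y [ k ]≔ j))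
  lattice-move {y} {k} {j} hy j<yₖ rewrite pos-interior y hy =
    Move-respʳ (pos-update hy k j)
      (update-move (full W y) (leaf k) j (leafLeaf k) (subst (j <_) (sym (sizeAt-leaf y k)) j<yₖ))

  lattice-move-inv : ∀ {y q} → Interior y → Move (pos W y) q →
    Σ (Fin d) λ k → Σ ℕ λ j → j < lookup y k × (IsP q → IsP (pos W (y [ k ]≔ j)))
  lattice-move-inv {y} hy mv with move⇒update (subst (λ p → Move p _) (pos-interior y hy) mv)
  ... | v , j , lf , j<s , q≈ with allLeaf v lf
  ...   | k , refl =
    k , j , subst (j <_) (sizeAt-leaf y k) j<s , IsP-resp (pos-update hy k j) ∘ IsP-resp q≈

  middle⇒interior : ∀ (B : Barrier W) {M x} → IsMiddleSet W B M → M x → Interior x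
  middle⇒interior B {x = x} (inL , _) mx i = n≢0⇒n>0 λ xᵢ≡0 →
    let (amoz , x∈L) = inL x mx in
    true≢false (trans (sym (Barrier.extU B x amoz (i , xᵢ≡0))) x∈L)

  U-closed-below : ∀ (B : Barrier W) {y k j m} → Interior y → Barrier.side B (y [ k ]≔ j) ≡ true →
                   m ≤ j → Barrier.side B (y [ k ]≔ m) ≡ true
  U-closed-below B {y} {k} {j} {m} hy yⱼ∈U m≤j with m≤n⇒m<n∨m≡n m≤j
  ... | inj₂ refl = yⱼ∈U
  ... | inj₁ m<j  =
    subst (λ z → Barrier.side B z ≡ true) ([]≔-idempotent y k)
      (Barrier.closed B (y [ k ]≔ j) ((y [ k ]≔ j) [ k ]≔ m)
        (update-atMostOneZero {x = y} hy) (update-atMostOneZero {x = y [ k ]≔ j} hyⱼ) yⱼ∈U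
        (lattice-move hyⱼ (subst (m <_) (sym (lookup∘update k y j)) m<j)))
    where
    hyⱼ : Interior (y [ k ]≔ j)
    hyⱼ = update-interior {x = y} hy (<-≤-trans z<s m<j)

  shadowed-intro : ∀ (B : Barrier W) {y k j} → Interior y → Barrier.side B y ≡ false →
                   IsP (pos W (y [ k ]≔ j)) → Barrier.side B (y [ k ]≔ j) ≡ true → Shadowed W B k y
  shadowed-intro B {y} {k} {j} hy y∈L Pyⱼ yⱼ∈U =
    (lookup y k , subst (λ z → Barrier.side B z ≡ false) (sym ([]≔-lookup y k)) y∈L) ,
    (j , Pyⱼ , λ m m≤j → U-closed-below B hy yⱼ∈U m≤j)

  shadowed⇒¬IsP : ∀ (B : Barrier W) {x k} → Interior x → Barrier.side B x ≡ false →
                  Shadowed W B k x → ¬ IsP (pos W x)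
  shadowed⇒¬IsP B {x} {k} hx x∈L (_ , m , Pₘ , belowU) Px with m <? lookup x k
  ... | yes m<xₖ = IsP-elim Px (lattice-move hx m<xₖ) Pₘ
  ... | no m≮xₖ  = true≢false (trans (sym (belowU (lookup x k) (≮⇒≥ m≮xₖ)))
                                     (trans (cong (Barrier.side B) ([]≔-lookup x k)) x∈L))

PartiallyIsomorphic-sym : ∀ {d} (W V : World d) B C MB MC t →
  PartiallyIsomorphic W V B C MB MC t → PartiallyIsomorphic V W C B MC MB (map ℤ.-_ t)
PartiallyIsomorphic-sym W V B C MB MC t (toMC , toMB , shadow) =
  (λ y my → let (x , mx , x~y) = toMB y my in x , mx , Translates-sym t x y x~y) ,
  (λ x mx → let (y , my , x~y) = toMC x mx in y , my , Translates-sym t x y x~y) ,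
  shadow′
  where
  shadow′ : ∀ k a b → FixedPos V k a → FixedPos W k b → TranslatesExcept k (map ℤ.-_ t) a b →
            (∃ λ m → MC (ray V k a m)) → Shadowed V C k a ⇔ Shadowed W B k b
  shadow′ k a b fixedA fixedB a~b (m , my) =
    let (x , mx , x~y) = toMB (ray V k a m) my
        x≡ray : x ≡ ray W k b (lookup x k)
        x≡ray = TranslatesExcept-unique t b x a k b~a (Translates-[]≔ t x a k m x~y)
    in ⇔.sym (shadow k b a fixedB fixedA b~a (lookup x k , subst MB x≡ray mx))
    where
    b~a : TranslatesExcept k t b a
    b~a i i≢k = trans (shift-flip (lookup a i) (lookup b i) (lookup (map ℤ.-_ t) i) (a~b i i≢k))
      (cong (λ z → + lookup a i ℤ.+ z)
            (trans (cong ℤ.-_ (lookup-map i ℤ.-_ t)) (ℤP.neg-involutive (lookup t i))))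

record PartialIsomorphism (d : ℕ) : Set₁ where
  field
    W V     : World d
    B       : Barrier W
    C       : Barrier V
    MB MC   : Vec ℕ d → Set
    middleB : IsMiddleSet W B MB
    middleC : IsMiddleSet V C MC
    t       : Vec ℤ d
    isPartiallyIsomorphic : PartiallyIsomorphic W V B C MB MC t

  reverse : PartialIsomorphism d
  reverse = record
    { W = V ; V = W ; B = C ; C = B ; MB = MC ; MC = MB ; middleB = middleC ; middleC = middleB
    ; t = map ℤ.-_ t
    ; isPartiallyIsomorphic = PartiallyIsomorphic-sym W V B C MB MC t isPartiallyIsomorphic
    }

IsP-transfer : ∀ N {d} (I : PartialIsomorphism d) → let open PartialIsomorphism I in
  ∀ {x y} → MB x → MC y → Translates t x y →
  measure (pos W x) + measure (pos V y) < N → IsP (pos W x) → IsP (pos V y)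
IsP-transfer (suc N) I {x} {y} mx my x~y bound Px =
  IsP-intro λ q mv Pq →
    let (k , j , j<yₖ , Pq⇒Pyⱼ) = lattice-move-inv V hy mv
    in [ no-move-to-U k j (Pq⇒Pyⱼ Pq) , no-move-to-M k j j<yₖ (Pq⇒Pyⱼ Pq) ]′
         (proj₂ middleC y (y [ k ]≔ j) my (update-atMostOneZero {x = y} hy) (lattice-move V hy j<yₖ))
  where
  open PartialIsomorphism I

  hx : Interior x
  hx = middle⇒interior W B middleB mx

  hy : Interior y
  hy = middle⇒interior V C middleC my

  toMB : ∀ y′ → MC y′ → ∃ λ x′ → MB x′ × Translates t x′ y′
  toMB = proj₁ (proj₂ isPartiallyIsomorphic)

  shadowed-V⇒W : ∀ k → Shadowed V C k y → Shadowed W B k x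
  shadowed-V⇒W k = Equivalence.from
    (proj₂ (proj₂ isPartiallyIsomorphic) k x y (λ i _ → hx i) (λ i _ → hy i) (λ i _ → x~y i)
      (lookup x k , subst MB (sym ([]≔-lookup x k)) mx))

  matched-move : ∀ {k j x′} → j < lookup y k → Translates t x′ (y [ k ]≔ j) → Move (pos W x) (pos W x′)
  matched-move {k} {j} {x′} j<yₖ x′~yⱼ =
    subst (λ z → Move (pos W x) (pos W z))
      (sym (TranslatesExcept-unique t x x′ y k (λ i _ → x~y i) (Translates-[]≔ t x′ y k j x′~yⱼ)))
      (lattice-move W hx (Translates-< t x y x′ (y [ k ]≔ j) k x~y x′~yⱼ
                            (subst (_< lookup y k) (sym (lookup∘update k y j)) j<yₖ)))

  decreasing : ∀ {x′ y′} → Move (pos W x) (pos W x′) → Move (pos V y) (pos V y′) →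
               measure (pos V y′) + measure (pos W x′) < N
  decreasing mvx mvy = <-≤-trans (+-mono-< (measure-< mvy) (measure-< mvx))
                                 (subst (_≤ N) (+-comm (measure (pos W x)) _) (s≤s⁻¹ bound))

  no-move-to-U : ∀ k j → IsP (pos V (y [ k ]≔ j)) → Barrier.side C (y [ k ]≔ j) ≡ true → ⊥
  no-move-to-U k j Pyⱼ yⱼ∈U =
    shadowed⇒¬IsP W B hx (proj₂ (proj₁ middleB x mx))
      (shadowed-V⇒W k (shadowed-intro V C hy (proj₂ (proj₁ middleC y my)) Pyⱼ yⱼ∈U)) Px

  no-move-to-M : ∀ k j → j < lookup y k → IsP (pos V (y [ k ]≔ j)) → MC (y [ k ]≔ j) → ⊥
  no-move-to-M k j j<yₖ Pyⱼ yⱼ∈M =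
    let (x′ , x′∈M , x′~yⱼ) = toMB (y [ k ]≔ j) yⱼ∈M
        mvx = matched-move j<yₖ x′~yⱼ
    in IsP-elim Px mvx
         (IsP-transfer N reverse yⱼ∈M x′∈M (Translates-sym t x′ (y [ k ]≔ j) x′~yⱼ)
            (decreasing mvx (lattice-move V hy j<yₖ)) Pyⱼ)

mainTheorem6 : ∀ {d : ℕ} (W V : World d) (B : Barrier W) (C : Barrier V)
                 (MB MC : Vec ℕ d → Set) →
                 IsMiddleSet W B MB → IsMiddleSet V C MC →
                 (t : Vec ℤ d) → PartiallyIsomorphic W V B C MB MC t →
                 ∀ (x y : Vec ℕ d) → MB x → MC y → Translates t x y →
                 IsP (pos W x) ⇔ IsP (pos V y)
mainTheorem6 W V B C MB MC middleB middleC t iso x y mx my x~y =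
  mk⇔ (IsP-transfer _ I mx my x~y (n<1+n _))
      (IsP-transfer _ (PartialIsomorphism.reverse I) my mx (Translates-sym t x y x~y) (n<1+n _))
  where
  I : PartialIsomorphism _
  I = record { W = W ; V = V ; B = B ; C = C ; MB = MB ; MC = MC
             ; middleB = middleB ; middleC = middleC ; t = t ; isPartiallyIsomorphic = iso }
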